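{- Let $G$ be a graph on $n\ge 5$ vertices and $m$ edges. If $\chi_s(G)=n-2$, then $m\ge \frac{n(n-3)}{6}$.
   Context: Standing assumption of the paper: all graphs are finite, undirected, simple and connected. A star coloring of $G$ is a proper vertex-coloring such that no path on four vertices (as a subgraph) is colored with only two colors; $\chi_s(G)$ is the minimum number of colors in a star coloring of $G$. -}

module Defs where

open import Data.Nat using (ℕ; zero; suc; _+_; _<_)
open import Data.Fin using (Fin; toℕ)
open import Data.Bool using (Bool; true; false; if_then_else_)
open import Data.List using (List; length; filter)
open import Data.List using (allFin)
open import Data.List using (concatMap; map)
open import Data.Product using (_×_; _,_; proj₁; proj₂; Σ)
open import Relation.Binary.PropositionalEquality using (_≡_; _≢_)
open import Relation.Nullary using (¬_)
open import Relation.Nullary.Decidable using (⌊_⌋)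
open import Data.Nat using (_<?_)
open import Data.Bool using (_∧_)
open import Data.Bool using () renaming (_≟_ to _Bool≟_)
open import Data.Sum using () renaming (_⊎_ to _⊎'_)

record Graph (n : ℕ) : Set where
  field
    adj   : Fin n → Fin n → Bool
    sym   : ∀ i j → adj i j ≡ adj j i
    irrefl : ∀ i → adj i i ≡ false

open Graph public

Adj : ∀ {n} → Graph n → Fin n → Fin n → Set
Adj G i j = adj G i j ≡ true

data Reach {n : ℕ} (G : Graph n) : Fin n → Fin n → Set where
  here : ∀ {i} → Reach G i i
  step : ∀ {i j k} → Adj G i j → Reach G j k → Reach G i k

Connected : ∀ {n} → Graph n → Set
Connected G = ∀ i j → Reach G i j

allPairs : (n : ℕ) → List (Fin n × Fin n)
allPairs n = concatMap (λ i → map (λ j → (i , j)) (allFin n)) (allFin n)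

edgeCount : ∀ {n} → Graph n → ℕ
edgeCount {n} G =
  length (filter (λ p → (⌊ toℕ (proj₁ p) <? toℕ (proj₂ p) ⌋ ∧ adj G (proj₁ p) (proj₂ p)) Bool≟ true)
                 (allPairs n))

Proper : ∀ {n k} → Graph n → (Fin n → Fin k) → Set
Proper G c = ∀ i j → Adj G i j → c i ≢ c j

-- A path on four vertices a-b-c-d as a subgraph (distinct vertices, consecutive adjacent)
-- colored with at most two colors.  In a proper coloring this is a bicolored P4.
TwoColoredP4 : ∀ {n k} → Graph n → (Fin n → Fin k) → Set
TwoColoredP4 {n} {k} G c =
  Σ (Fin n) λ a → Σ (Fin n) λ b → Σ (Fin n) λ x → Σ (Fin n) λ d →
    (a ≢ b) × (a ≢ x) × (a ≢ d) × (b ≢ x) × (b ≢ d) × (x ≢ d) ×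
    Adj G a b × Adj G b x × Adj G x d ×
    Σ (Fin k) λ α → Σ (Fin k) λ β →
      (c a ≡ α ⊎' c a ≡ β) × (c b ≡ α ⊎' c b ≡ β) ×
      (c x ≡ α ⊎' c x ≡ β) × (c d ≡ α ⊎' c d ≡ β)

StarColoring : ∀ {n k} → Graph n → (Fin n → Fin k) → Set
StarColoring G c = Proper G c × ¬ TwoColoredP4 G c

StarColorable : ∀ {n} → Graph n → ℕ → Set
StarColorable {n} G k = Σ (Fin n → Fin k) λ c → StarColoring G c

StarChromaticNumber : ∀ {n} → Graph n → ℕ → Set
StarChromaticNumber G k = StarColorable G k × (∀ j → j < k → ¬ StarColorable G j)

-- If G had four pairwise non-adjacent vertices, giving them one common color and every other
-- vertex a color of its own would be a star coloring with n − 3 colors: a bicolored P₄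
-- x₁x₂x₃x₄ repeats colors on x₁,x₃ and on x₂,x₄, so the adjacent x₁,x₂ would both lie in the
-- common class. Hence χ_s(G) = n − 2 forces α(G) ≤ 3, and the Turán-type bound
-- |S|(|S| − r) ≤ r · 2e(S), valid when α < r + 1, gives n(n − 3) ≤ 6m. That bound is proved by
-- induction on |S|: a maximal independent set D ⊆ S has at most r vertices and every vertex of
-- S ∖ D has a neighbour in D, so removing D loses at most r vertices and at least |S ∖ D| edges.

module Submission where

open import Defs
open import Data.Nat using (ℕ; zero; suc; _+_; _*_; _∸_; _≤_; _<_; z≤n; s≤s; _<?_)
open import Data.Nat.Properties
open import Data.Nat.Tactic.RingSolver using (solve-∀)
open import Data.Fin as Fin using (Fin; toℕ; punchOut)
import Data.Fin.Properties as Fin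
open import Data.Bool using (Bool; true; false; _∧_; _∨_; not)
open import Data.Bool.Properties using (∧-assoc; ∧-comm; not-¬)
open import Data.Bool using () renaming (_≟_ to _≟ᵇ_)
open import Data.List using (List; []; _∷_; _++_; length; filter; tabulate; concatMap; map; allFin)
import Data.List.Properties as List
open import Data.List.Relation.Unary.All as All using (All; []; _∷_)
open import Data.List.Relation.Unary.All.Properties using (¬All⇒Any¬)
open import Data.List.Relation.Unary.Any using (Any; here; there)
open import Data.List.Relation.Unary.AllPairs as AllPairs using (AllPairs; []; _∷_)
open import Data.List.Membership.Propositional using (_∈_; _∉_)
open import Data.Product as Product using (Σ; ∃-syntax; _×_; _,_; proj₁; proj₂)
open import Data.Sum as Sum using (_⊎_; inj₁; inj₂)
open import Data.Empty using (⊥-elim)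
open import Function using (_∘_)
open import Relation.Binary.PropositionalEquality hiding (J) renaming (sym to ≡-sym)
open import Relation.Nullary using (Dec; yes; no; does; ¬_)
open import Relation.Nullary.Decidable using (dec-true; ⌊_⌋; ¬?; _×-dec_)
open import Relation.Unary using (Pred; Decidable)
open import Algebra.Properties.CommutativeMonoid.Sum +-0-commutativeMonoid
  using (sum; sum-syntax; ∑-distrib-+; ∑-comm; sum-cong-≗; sum-replicate-zero)

𝟙 : Bool → ℕ
𝟙 true  = 1
𝟙 false = 0

𝟙-does-≟true : ∀ b → 𝟙 (does (b ≟ᵇ true)) ≡ 𝟙 b
𝟙-does-≟true true  = refl
𝟙-does-≟true false = refl

𝟙-split : ∀ s t x → 𝟙 (s ∧ x) ≡ 𝟙 ((s ∧ not t) ∧ x) + 𝟙 ((s ∧ t) ∧ x)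
𝟙-split true  true  x = refl
𝟙-split true  false x = ≡-sym (+-identityʳ _)
𝟙-split false t     x = refl

∧-swapˡ : ∀ a b c → a ∧ (b ∧ c) ≡ b ∧ (a ∧ c)
∧-swapˡ a b c = trans (≡-sym (∧-assoc a b c)) (trans (cong (_∧ c) (∧-comm a b)) (∧-assoc b a c))

≡true⇒≢false : ∀ {b} → b ≡ true → b ≢ false
≡true⇒≢false refl ()

∧≡true : ∀ {a b} → a ∧ b ≡ true → a ≡ true × b ≡ true
∧≡true {true} {true} refl = refl , refl

∑-mono-≤ : ∀ {n} {f g : Fin n → ℕ} → (∀ i → f i ≤ g i) → sum f ≤ sum g
∑-mono-≤ {zero}  _   = z≤n
∑-mono-≤ {suc n} f≤g = +-mono-≤ (f≤g Fin.zero) (∑-mono-≤ (f≤g ∘ Fin.suc))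

term≤∑ : ∀ {n} (f : Fin n → ℕ) i → f i ≤ sum f
term≤∑ f Fin.zero    = m≤m+n _ _
term≤∑ f (Fin.suc i) = ≤-trans (term≤∑ (f ∘ Fin.suc) i) (m≤n+m _ _)

∑-zero : ∀ {n} {f : Fin n → ℕ} → (∀ i → f i ≡ 0) → sum f ≡ 0
∑-zero {n} f≡0 = trans (sum-cong-≗ f≡0) (sum-replicate-zero n)

∑-one : ∀ n → ∑[ i < n ] 1 ≡ n
∑-one zero    = refl
∑-one (suc n) = cong suc (∑-one n)

∑-𝟙-≟ : ∀ {n} (u : Fin n) → ∑[ v < n ] 𝟙 (does (v Fin.≟ u)) ≡ 1
∑-𝟙-≟ {suc n} Fin.zero    = cong suc (∑-zero {n} (λ _ → refl))
∑-𝟙-≟         (Fin.suc u) = ∑-𝟙-≟ u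

∑∑-distrib-+ : ∀ {m n} (f g : Fin m → Fin n → ℕ) →
  ∑[ i < m ] ∑[ j < n ] (f i j + g i j) ≡ ∑[ i < m ] ∑[ j < n ] f i j + ∑[ i < m ] ∑[ j < n ] g i j
∑∑-distrib-+ f g = trans (sum-cong-≗ (λ i → ∑-distrib-+ (f i) (g i)))
                         (∑-distrib-+ (λ i → sum (f i)) (λ i → sum (g i)))

module _ {a p} {A : Set a} {P : Pred A p} (P? : Decidable P) where

  length-filter-tabulate : ∀ {n} (f : Fin n → A) →
    length (filter P? (tabulate f)) ≡ ∑[ i < n ] 𝟙 (does (P? (f i)))
  length-filter-tabulate {zero}  f = refl
  length-filter-tabulate {suc n} f with does (P? (f Fin.zero))
  ... | true  = cong suc (length-filter-tabulate (f ∘ Fin.suc))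
  ... | false = length-filter-tabulate (f ∘ Fin.suc)

  length-filter-concatMap-tabulate : ∀ {b} {B : Set b} {n} (g : B → List A) (f : Fin n → B) →
    length (filter P? (concatMap g (tabulate f))) ≡ ∑[ i < n ] length (filter P? (g (f i)))
  length-filter-concatMap-tabulate {n = zero}  g f = refl
  length-filter-concatMap-tabulate {n = suc n} g f = begin
    length (filter P? (g (f Fin.zero) ++ rest))                ≡⟨ cong length (List.filter-++ P? (g (f Fin.zero)) rest) ⟩
    length (filter P? (g (f Fin.zero)) ++ filter P? rest)      ≡⟨ List.length-++ (filter P? (g (f Fin.zero))) ⟩
    length (filter P? (g (f Fin.zero))) + length (filter P? rest)
      ≡⟨ cong (length (filter P? (g (f Fin.zero))) +_) (length-filter-concatMap-tabulate g (f ∘ Fin.suc)) ⟩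
    ∑[ i < suc n ] length (filter P? (g (f i)))                ∎
    where
    open ≡-Reasoning
    rest : List A
    rest = concatMap g (tabulate (f ∘ Fin.suc))

module _ {n : ℕ} (G : Graph n) where

  forwardEdge : Fin n → Fin n → Bool
  forwardEdge i j = ⌊ toℕ i <? toℕ j ⌋ ∧ adj G i j

  edgeCount≡∑∑forwardEdge : edgeCount G ≡ ∑[ i < n ] ∑[ j < n ] 𝟙 (forwardEdge i j)
  edgeCount≡∑∑forwardEdge =
    trans (length-filter-concatMap-tabulate forwardEdge? (λ i → map (i ,_) (allFin n)) (λ i → i))
          (sum-cong-≗ row)
    where
    forwardEdge? : Decidable (λ (p : Fin n × Fin n) → forwardEdge (proj₁ p) (proj₂ p) ≡ true)
    forwardEdge? p = forwardEdge (proj₁ p) (proj₂ p) ≟ᵇ true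
    row : ∀ i → length (filter forwardEdge? (map (i ,_) (allFin n))) ≡ ∑[ j < n ] 𝟙 (forwardEdge i j)
    row i = begin
      length (filter forwardEdge? (map (i ,_) (allFin n)))
        ≡⟨ cong (length ∘ filter forwardEdge?) (List.map-tabulate (λ j → j) (i ,_)) ⟩
      length (filter forwardEdge? (tabulate (i ,_)))
        ≡⟨ length-filter-tabulate forwardEdge? (i ,_) ⟩
      ∑[ j < n ] 𝟙 (does (forwardEdge? (i , j)))
        ≡⟨ sum-cong-≗ {n} (λ j → 𝟙-does-≟true (forwardEdge i j)) ⟩
      ∑[ j < n ] 𝟙 (forwardEdge i j)
        ∎
      where open ≡-Reasoning

  forwardEdge+backwardEdge : ∀ i j → 𝟙 (forwardEdge i j) + 𝟙 (forwardEdge j i) ≡ 𝟙 (adj G i j)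
  forwardEdge+backwardEdge i j with toℕ i <? toℕ j | toℕ j <? toℕ i
  ... | yes i<j | yes j<i = ⊥-elim (<-asym i<j j<i)
  ... | yes _   | no _    = +-identityʳ _
  ... | no _    | yes _   = cong 𝟙 (sym G j i)
  ... | no i≮j  | no j≮i with Fin.toℕ-injective (≤-antisym (≮⇒≥ j≮i) (≮⇒≥ i≮j))
  ...   | refl rewrite irrefl G i = refl

  handshake : 2 * edgeCount G ≡ ∑[ i < n ] ∑[ j < n ] 𝟙 (adj G i j)
  handshake = begin
    2 * edgeCount G                                   ≡⟨ cong (edgeCount G +_) (+-identityʳ _) ⟩
    edgeCount G + edgeCount G                         ≡⟨ cong₂ _+_ edgeCount≡∑∑forwardEdge edgeCount≡∑∑forwardEdge ⟩
    ∑∑ fwd + ∑[ i < n ] ∑[ j < n ] fwd i j           ≡⟨ cong (∑∑ fwd +_) (∑-comm fwd) ⟩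
    ∑∑ fwd + ∑[ i < n ] ∑[ j < n ] fwd j i           ≡⟨ ∑∑-distrib-+ fwd (λ i j → fwd j i) ⟨
    ∑[ i < n ] ∑[ j < n ] (fwd i j + fwd j i)         ≡⟨ sum-cong-≗ (λ i → sum-cong-≗ (forwardEdge+backwardEdge i)) ⟩
    ∑[ i < n ] ∑[ j < n ] 𝟙 (adj G i j)               ∎
    where
    open ≡-Reasoning
    fwd : Fin n → Fin n → ℕ
    fwd i j = 𝟙 (forwardEdge i j)
    ∑∑ : (Fin n → Fin n → ℕ) → ℕ
    ∑∑ f = ∑[ i < n ] ∑[ j < n ] f i j

size : ∀ {n} → (Fin n → Bool) → ℕ
size {n} S = ∑[ i < n ] 𝟙 (S i)

infixl 7 _∩_ _∖_

_∩_ _∖_ : ∀ {n} → (Fin n → Bool) → (Fin n → Bool) → Fin n → Bool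
(S ∩ T) i = S i ∧ T i
(S ∖ T) i = S i ∧ not (T i)

size≡0⊎nonempty : ∀ {n} (S : Fin n → Bool) → size S ≡ 0 ⊎ ∃[ a ] S a ≡ true
size≡0⊎nonempty {zero}  S = inj₁ refl
size≡0⊎nonempty {suc n} S with S Fin.zero in S0
... | true  = inj₂ (Fin.zero , S0)
... | false = Sum.map₂ (λ (a , Sa) → Fin.suc a , Sa) (size≡0⊎nonempty (S ∘ Fin.suc))

size-split : ∀ {n} (S T : Fin n → Bool) → size S ≡ size (S ∖ T) + size (S ∩ T)
size-split S T = trans (sum-cong-≗ split) (∑-distrib-+ (λ i → 𝟙 ((S ∖ T) i)) (λ i → 𝟙 ((S ∩ T) i)))
  where
  split : ∀ i → 𝟙 (S i) ≡ 𝟙 ((S ∖ T) i) + 𝟙 ((S ∩ T) i)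
  split i with S i | T i
  ... | true  | true  = refl
  ... | true  | false = refl
  ... | false | _     = refl

size-∩-≤ʳ : ∀ {n} (S T : Fin n → Bool) → size (S ∩ T) ≤ size T
size-∩-≤ʳ S T = ∑-mono-≤ λ i → ∧-≤ʳ (S i) (T i)
  where
  ∧-≤ʳ : ∀ s t → 𝟙 (s ∧ t) ≤ 𝟙 t
  ∧-≤ʳ true  t = ≤-refl
  ∧-≤ʳ false t = z≤n

module _ {n : ℕ} (G : Graph n) where

  -- Counts ordered pairs, so edgesBetween G S S is twice the number of edges inside S.
  edgesBetween : (S T : Fin n → Bool) → ℕ
  edgesBetween S T = ∑[ i < n ] ∑[ j < n ] 𝟙 (S i ∧ T j ∧ adj G i j)

  edgesBetween-comm : ∀ S T → edgesBetween S T ≡ edgesBetween T S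
  edgesBetween-comm S T = trans (∑-comm {n} {n} _) (sum-cong-≗ {n} λ j → sum-cong-≗ {n} λ i →
    cong 𝟙 (trans (∧-swapˡ (S i) (T j) (adj G i j)) (cong (λ b → T j ∧ S i ∧ b) (sym G i j))))

  edgesBetween-splitˡ : ∀ S T I → edgesBetween S T ≡ edgesBetween (S ∖ I) T + edgesBetween (S ∩ I) T
  edgesBetween-splitˡ S T I =
    trans (sum-cong-≗ {n} λ i → sum-cong-≗ {n} λ j → 𝟙-split (S i) (I i) (T j ∧ adj G i j)) (∑∑-distrib-+ {n} {n} _ _)

  edgesBetween-splitʳ : ∀ S T I → edgesBetween S T ≡ edgesBetween S (T ∖ I) + edgesBetween S (T ∩ I)
  edgesBetween-splitʳ S T I = begin
    edgesBetween S T                                 ≡⟨ edgesBetween-comm S T ⟩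
    edgesBetween T S                                 ≡⟨ edgesBetween-splitˡ T S I ⟩
    edgesBetween (T ∖ I) S + edgesBetween (T ∩ I) S
      ≡⟨ cong₂ _+_ (edgesBetween-comm (T ∖ I) S) (edgesBetween-comm (T ∩ I) S) ⟩
    edgesBetween S (T ∖ I) + edgesBetween S (T ∩ I)  ∎
    where open ≡-Reasoning

  edgesBetween-∖-∩ : ∀ S I →
    edgesBetween (S ∖ I) (S ∖ I) + edgesBetween (S ∖ I) (S ∩ I) + edgesBetween (S ∖ I) (S ∩ I) ≤ edgesBetween S S
  edgesBetween-∖-∩ S I = begin
    E S′ S′ + E S′ J + E S′ J          ≡⟨ cong (E S′ S′ + E S′ J +_) (edgesBetween-comm S′ J) ⟩
    E S′ S′ + E S′ J + E J S′          ≤⟨ +-monoʳ-≤ (E S′ S′ + E S′ J) (m≤m+n (E J S′) (E J J)) ⟩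
    E S′ S′ + E S′ J + (E J S′ + E J J) ≡⟨ cong₂ _+_ (edgesBetween-splitʳ S′ S I) (edgesBetween-splitʳ J S I) ⟨
    E S′ S + E J S                     ≡⟨ edgesBetween-splitˡ S S I ⟨
    E S S                              ∎
    where
    open ≤-Reasoning
    E : (Fin n → Bool) → (Fin n → Bool) → ℕ
    E = edgesBetween
    S′ J : Fin n → Bool
    S′ = S ∖ I
    J = S ∩ I

  size≤edgesBetween : ∀ S T → (∀ v → S v ≡ true → ∃[ u ] T u ≡ true × Adj G v u) → size S ≤ edgesBetween S T
  size≤edgesBetween S T dominated = ∑-mono-≤ row
    where
    row : ∀ v → 𝟙 (S v) ≤ ∑[ u < n ] 𝟙 (S v ∧ T u ∧ adj G v u)
    row v with S v in Sv
    ... | false = z≤n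
    ... | true with dominated v Sv
    ...   | u , Tu , vu = subst (_≤ _) (cong₂ (λ a b → 𝟙 (a ∧ b)) Tu vu) (term≤∑ (λ u → 𝟙 (T u ∧ adj G v u)) u)

Independent : ∀ {n} → Graph n → List (Fin n) → Set
Independent G = AllPairs (λ u v → u ≢ v × adj G u v ≡ false)

NoIndependentSetOfSize : ∀ {n} → Graph n → ℕ → Set
NoIndependentSetOfSize G k = ∀ I → Independent G I → length I ≢ k

Dominates : ∀ {n} → Graph n → List (Fin n) → (Fin n → Bool) → Set
Dominates G D S = ∀ v → S v ≡ true → v ∉ D → ∃[ u ] u ∈ D × Adj G v u

module _ {n : ℕ} (G : Graph n) where

  nonadjacent? : ∀ v u → Dec (v ≢ u × adj G v u ≡ false)
  nonadjacent? v u = ¬? (v Fin.≟ u) ×-dec (adj G v u ≟ᵇ false)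

  neighbourIn : ∀ {v D} → v ∉ D → Any (λ u → ¬ (v ≢ u × adj G v u ≡ false)) D → ∃[ u ] u ∈ D × Adj G v u
  neighbourIn {v} {u ∷ D} v∉D (here adjacent) with v Fin.≟ u | adj G v u in vu
  ... | yes v≡u | _     = ⊥-elim (v∉D (here v≡u))
  ... | no _    | true  = u , here refl , vu
  ... | no v≢u  | false = ⊥-elim (adjacent (v≢u , refl))
  neighbourIn v∉D (there p) with neighbourIn (v∉D ∘ there) p
  ... | u , u∈D , vu = u , there u∈D , vu

  -- Extends I greedily inside S; running out of fuel would produce an independent set of size r + 1.
  greedyDominatingSet : ∀ {r} → NoIndependentSetOfSize G (suc r) → ∀ S fuel I →
    Independent G I → All (λ u → S u ≡ true) I → length I + fuel ≡ suc r →
    ∃[ D ] length D ≤ r × All (λ u → S u ≡ true) D × Dominates G D S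
  greedyDominatingSet noInd S zero I indI _ |I|+0≡1+r =
    ⊥-elim (noInd I indI (trans (≡-sym (+-identityʳ (length I))) |I|+0≡1+r))
  greedyDominatingSet noInd S (suc fuel) I indI I⊆S |I|+fuel≡1+r
    with Fin.any? (λ v → (S v ≟ᵇ true) ×-dec All.all? (nonadjacent? v) I)
  ... | yes (v , Sv , v#I) =
    greedyDominatingSet noInd S fuel (v ∷ I) (v#I ∷ indI) (Sv ∷ I⊆S) (trans (≡-sym (+-suc (length I) fuel)) |I|+fuel≡1+r)
  ... | no maximal = I , |I|≤r , I⊆S , dominates
    where
    |I|≤r : length I ≤ _
    |I|≤r = ≤-pred (subst (length I <_) |I|+fuel≡1+r (m<m+n (length I) (s≤s z≤n)))
    dominates : Dominates G I S
    dominates v Sv v∉I = neighbourIn v∉I (¬All⇒Any¬ (nonadjacent? v) I (λ v#I → maximal (v , Sv , v#I)))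

module _ {n : ℕ} where
  open import Data.List.Membership.DecPropositional (Fin._≟_ {n}) using (_∈?_)

  _∈ᵇ_ : Fin n → List (Fin n) → Bool
  v ∈ᵇ D = does (v ∈? D)

  ∈⇒∈ᵇ : ∀ {v D} → v ∈ D → v ∈ᵇ D ≡ true
  ∈⇒∈ᵇ {v} {D} = dec-true (v ∈? D)

  size-∈ᵇ≤length : ∀ D → size (_∈ᵇ D) ≤ length D
  size-∈ᵇ≤length [] = ≤-reflexive (∑-zero {n} (λ _ → refl))
  size-∈ᵇ≤length (u ∷ D) = begin
    ∑[ v < n ] 𝟙 (does (v Fin.≟ u) ∨ v ∈ᵇ D)
      ≤⟨ ∑-mono-≤ (λ v → 𝟙-∨ (does (v Fin.≟ u)) (v ∈ᵇ D)) ⟩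
    ∑[ v < n ] (𝟙 (does (v Fin.≟ u)) + 𝟙 (v ∈ᵇ D))
      ≡⟨ ∑-distrib-+ (λ v → 𝟙 (does (v Fin.≟ u))) (λ v → 𝟙 (v ∈ᵇ D)) ⟩
    ∑[ v < n ] 𝟙 (does (v Fin.≟ u)) + size (_∈ᵇ D)
      ≤⟨ +-mono-≤ (≤-reflexive (∑-𝟙-≟ u)) (size-∈ᵇ≤length D) ⟩
    suc (length D)
      ∎
    where
    open ≤-Reasoning
    𝟙-∨ : ∀ a b → 𝟙 (a ∨ b) ≤ 𝟙 a + 𝟙 b
    𝟙-∨ true  b = s≤s z≤n
    𝟙-∨ false b = ≤-refl

  module _ (G : Graph n) {S : Fin n → Bool} {D : List (Fin n)}
           (D⊆S : All (λ u → S u ≡ true) D) (dominates : Dominates G D S) where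

    private
      S′ J : Fin n → Bool
      S′ = S ∖ (_∈ᵇ D)
      J = S ∩ (_∈ᵇ D)

      ∈D⇒J : ∀ {u} → u ∈ D → J u ≡ true
      ∈D⇒J u∈D = cong₂ _∧_ (All.lookup D⊆S u∈D) (∈⇒∈ᵇ u∈D)

      covered : ∀ v → S′ v ≡ true → ∃[ u ] J u ≡ true × Adj G v u
      covered v S′v with ∧≡true {S v} S′v
      ... | Sv , v∉ᵇD with dominates v Sv (λ v∈D → not-¬ (≡-sym (∈⇒∈ᵇ v∈D)) (≡-sym v∉ᵇD))
      ...   | u , u∈D , vu = u , ∈D⇒J u∈D , vu

      1≤size-J : ∀ {a} → S a ≡ true → 1 ≤ size J
      1≤size-J {a} Sa with a ∈? D
      ... | yes a∈D = subst (_≤ size J) (cong 𝟙 (∈D⇒J a∈D)) (term≤∑ (𝟙 ∘ J) a)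
      ... | no a∉D with dominates a Sa a∉D
      ...   | u , u∈D , _ = subst (_≤ size J) (cong 𝟙 (∈D⇒J u∈D)) (term≤∑ (𝟙 ∘ J) u)

    size≤length+size∖ : size S ≤ length D + size S′
    size≤length+size∖ = begin
      size S               ≡⟨ size-split S (_∈ᵇ D) ⟩
      size S′ + size J     ≡⟨ +-comm (size S′) (size J) ⟩
      size J + size S′     ≤⟨ +-monoˡ-≤ (size S′) (≤-trans (size-∩-≤ʳ S (_∈ᵇ D)) (size-∈ᵇ≤length D)) ⟩
      length D + size S′   ∎
      where open ≤-Reasoning

    size∖<size : ∀ {a} → S a ≡ true → size S′ < size S
    size∖<size Sa = subst (size S′ <_) (≡-sym (size-split S (_∈ᵇ D))) (m<m+n (size S′) (1≤size-J Sa))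

    edgesBetween-∖-dominating : edgesBetween G S′ S′ + size S′ + size S′ ≤ edgesBetween G S S
    edgesBetween-∖-dominating =
      ≤-trans (+-mono-≤ (+-monoʳ-≤ (edgesBetween G S′ S′) S′≤cross) S′≤cross) (edgesBetween-∖-∩ G S (_∈ᵇ D))
      where
      S′≤cross : size S′ ≤ edgesBetween G S′ J
      S′≤cross = size≤edgesBetween G S′ J covered

turán-arithmetic : ∀ {r s t e e′} → s ≤ r + t → t * (t ∸ r) ≤ r * e′ → e′ + t + t ≤ e → s * (s ∸ r) ≤ r * e
turán-arithmetic {r} {s} {t} {e} {e′} s≤r+t ih edges = begin
  s * (s ∸ r)                  ≤⟨ *-mono-≤ s≤r+t (m≤n+o⇒m∸n≤o s r s≤r+t) ⟩
  (r + t) * t                  ≡⟨ expand₁ r t ⟩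
  r * t + t * t                ≤⟨ +-monoʳ-≤ (r * t) (*-monoʳ-≤ t (m≤n+m∸n t r)) ⟩
  r * t + t * (r + (t ∸ r))    ≡⟨ expand₂ r t (t ∸ r) ⟩
  r * (t + t) + t * (t ∸ r)    ≤⟨ +-monoʳ-≤ (r * (t + t)) ih ⟩
  r * (t + t) + r * e′         ≡⟨ expand₃ r t e′ ⟩
  r * (e′ + t + t)             ≤⟨ *-monoʳ-≤ r edges ⟩
  r * e                        ∎
  where
  open ≤-Reasoning
  expand₁ : ∀ r t → (r + t) * t ≡ r * t + t * t
  expand₁ = solve-∀
  expand₂ : ∀ r t u → r * t + t * (r + u) ≡ r * (t + t) + t * u
  expand₂ = solve-∀
  expand₃ : ∀ r t e′ → r * (t + t) + r * e′ ≡ r * (e′ + t + t)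
  expand₃ = solve-∀

turánBound : ∀ {n r} (G : Graph n) → NoIndependentSetOfSize G (suc r) →
  ∀ S → size S * (size S ∸ r) ≤ r * edgesBetween G S S
turánBound {r = r} G noInd S = go (size S) S ≤-refl
  where
  go : ∀ k S → size S ≤ k → size S * (size S ∸ r) ≤ r * edgesBetween G S S
  go zero S |S|≤0 rewrite n≤0⇒n≡0 |S|≤0 = z≤n
  go (suc k) S |S|≤1+k with size≡0⊎nonempty S
  ... | inj₁ |S|≡0 rewrite |S|≡0 = z≤n
  ... | inj₂ (a , Sa) with greedyDominatingSet G noInd S (suc r) [] [] [] refl
  ... | D , |D|≤r , D⊆S , dominates =
    turán-arithmetic {r}
      (≤-trans (size≤length+size∖ G D⊆S dominates) (+-monoˡ-≤ _ |D|≤r))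
      (go k (S ∖ (_∈ᵇ D)) (≤-pred (≤-trans (size∖<size G D⊆S dominates Sa) |S|≤1+k)))
      (edgesBetween-∖-dominating G D⊆S dominates)

InjectiveOutside : ∀ {N K} → (Fin N → Fin K) → (Fin N → Set) → Set
InjectiveOutside col P = ∀ v w → col v ≡ col w → v ≡ w ⊎ (P v × P w)

InjectiveOutside-weaken : ∀ {N K} {col : Fin N → Fin K} {P Q : Fin N → Set} →
  (∀ {v} → P v → Q v) → InjectiveOutside col P → InjectiveOutside col Q
InjectiveOutside-weaken P⇒Q inj v w e = Sum.map₂ (Product.map P⇒Q P⇒Q) (inj v w e)

identify : ∀ {K} (x y : Fin (suc K)) → x ≢ y → Fin (suc K) → Fin K
identify x y x≢y z with z Fin.≟ y
... | yes _   = punchOut {i = y} {j = x} (x≢y ∘ ≡-sym)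
... | no z≢y = punchOut {i = y} {j = z} (z≢y ∘ ≡-sym)

identify-clash : ∀ {K} (x y : Fin (suc K)) (x≢y : x ≢ y) z w → identify x y x≢y z ≡ identify x y x≢y w →
                 z ≡ w ⊎ ((z ≡ x ⊎ z ≡ y) × (w ≡ x ⊎ w ≡ y))
identify-clash x y x≢y z w e with z Fin.≟ y | w Fin.≟ y
... | yes z≡y | yes w≡y = inj₁ (trans z≡y (≡-sym w≡y))
... | yes z≡y | no w≢y  = inj₂ (inj₂ z≡y , inj₁ (≡-sym (Fin.punchOut-injective (x≢y ∘ ≡-sym) (w≢y ∘ ≡-sym) e)))
... | no z≢y  | yes w≡y = inj₂ (inj₁ (Fin.punchOut-injective (z≢y ∘ ≡-sym) (x≢y ∘ ≡-sym) e) , inj₂ w≡y)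
... | no z≢y  | no w≢y  = inj₁ (Fin.punchOut-injective (z≢y ∘ ≡-sym) (w≢y ∘ ≡-sym) e)

identifyColors : ∀ {N K} {P : Fin N → Set} {p q} (col : Fin N → Fin (suc K)) →
  InjectiveOutside col P → P p → ¬ P q →
  Σ (Fin N → Fin K) λ col′ → InjectiveOutside col′ (λ v → v ≡ q ⊎ P v)
identifyColors {P = P} {p} {q} col inj Pp ¬Pq = identify (col p) (col q) cp≢cq ∘ col , inj′
  where
  cp≢cq : col p ≢ col q
  cp≢cq e with inj p q e
  ... | inj₁ refl     = ¬Pq Pp
  ... | inj₂ (_ , Pq) = ¬Pq Pq
  classOf : ∀ u → col u ≡ col p ⊎ col u ≡ col q → u ≡ q ⊎ P u
  classOf u (inj₁ e) with inj u p e
  ... | inj₁ refl     = inj₂ Pp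
  ... | inj₂ (Pu , _) = inj₂ Pu
  classOf u (inj₂ e) with inj u q e
  ... | inj₁ u≡q      = inj₁ u≡q
  ... | inj₂ (Pu , _) = inj₂ Pu
  inj′ : InjectiveOutside (identify (col p) (col q) cp≢cq ∘ col) (λ v → v ≡ q ⊎ P v)
  inj′ v w e with identify-clash (col p) (col q) cp≢cq (col v) (col w) e
  ... | inj₂ (cv , cw) = inj₂ (classOf v cv , classOf w cw)
  ... | inj₁ cv≡cw with inj v w cv≡cw
  ...   | inj₁ v≡w        = inj₁ v≡w
  ...   | inj₂ (Pv , Pw) = inj₂ (inj₂ Pv , inj₂ Pw)

identifyAll : ∀ {N K} {P : Fin N → Set} {p} (qs : List (Fin N)) (col : Fin N → Fin (length qs + K)) →
  InjectiveOutside col P → P p → AllPairs _≢_ qs → All (¬_ ∘ P) qs →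
  Σ (Fin N → Fin K) λ col′ → InjectiveOutside col′ (λ v → v ∈ qs ⊎ P v)
identifyAll [] col inj _ _ _ = col , InjectiveOutside-weaken inj₂ inj
identifyAll {P = P} (q ∷ qs) col inj Pp (q≢qs ∷ distinct) (¬Pq ∷ ¬Pqs) =
  let col₁ , inj₁′ = identifyColors col inj Pp ¬Pq
      col′ , inj′ = identifyAll qs col₁ inj₁′ (inj₂ Pp) distinct (All.zipWith fresh (q≢qs , ¬Pqs))
  in col′ , InjectiveOutside-weaken regroup inj′
  where
  fresh : ∀ {s} → q ≢ s × ¬ P s → ¬ (s ≡ q ⊎ P s)
  fresh (q≢s , _)   (inj₁ s≡q) = q≢s (≡-sym s≡q)
  fresh (_   , ¬Ps) (inj₂ Ps)  = ¬Ps Ps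
  regroup : ∀ {v} → v ∈ qs ⊎ (v ≡ q ⊎ P v) → v ∈ q ∷ qs ⊎ P v
  regroup (inj₁ v∈qs)       = inj₁ (there v∈qs)
  regroup (inj₂ (inj₁ v≡q)) = inj₁ (here v≡q)
  regroup (inj₂ (inj₂ Pv))  = inj₂ Pv

alternating : ∀ {ℓ} {A : Set ℓ} {x y z α β : A} →
              (x ≡ α ⊎ x ≡ β) → (y ≡ α ⊎ y ≡ β) → (z ≡ α ⊎ z ≡ β) → x ≢ y → y ≢ z → x ≡ z
alternating (inj₁ x≡α) (inj₁ y≡α) _          x≢y _   = ⊥-elim (x≢y (trans x≡α (≡-sym y≡α)))
alternating (inj₂ x≡β) (inj₂ y≡β) _          x≢y _   = ⊥-elim (x≢y (trans x≡β (≡-sym y≡β)))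
alternating _          (inj₁ y≡α) (inj₁ z≡α) _   y≢z = ⊥-elim (y≢z (trans y≡α (≡-sym z≡α)))
alternating _          (inj₂ y≡β) (inj₂ z≡β) _   y≢z = ⊥-elim (y≢z (trans y≡β (≡-sym z≡β)))
alternating (inj₁ x≡α) (inj₂ _)   (inj₁ z≡α) _   _   = trans x≡α (≡-sym z≡α)
alternating (inj₂ x≡β) (inj₁ _)   (inj₂ z≡β) _   _   = trans x≡β (≡-sym z≡β)

module _ {N : ℕ} (G : Graph N) where

  injectiveOutsideIndependent⇒starColoring : ∀ {K} {P : Fin N → Set} (col : Fin N → Fin K) →
    InjectiveOutside col P → (∀ {v w} → P v → P w → adj G v w ≡ false) → StarColoring G col
  injectiveOutsideIndependent⇒starColoring col inj nonadjacent = proper , noBicoloredP4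
    where
    proper : Proper G col
    proper v w vw e with inj v w e
    ... | inj₁ refl      = ≡true⇒≢false vw (irrefl G v)
    ... | inj₂ (Pv , Pw) = ≡true⇒≢false vw (nonadjacent Pv Pw)
    noBicoloredP4 : ¬ TwoColoredP4 G col
    noBicoloredP4 (x₁ , x₂ , x₃ , x₄ , _ , x₁≢x₃ , _ , _ , x₂≢x₄ , _ ,
                   x₁x₂ , x₂x₃ , x₃x₄ , _ , _ , c₁ , c₂ , c₃ , c₄)
      with inj x₁ x₃ (alternating c₁ c₂ c₃ (proper x₁ x₂ x₁x₂) (proper x₂ x₃ x₂x₃))
         | inj x₂ x₄ (alternating c₂ c₃ c₄ (proper x₂ x₃ x₂x₃) (proper x₃ x₄ x₃x₄))
    ... | inj₁ x₁≡x₃       | _               = x₁≢x₃ x₁≡x₃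
    ... | inj₂ _           | inj₁ x₂≡x₄      = x₂≢x₄ x₂≡x₄
    ... | inj₂ (Px₁ , _)   | inj₂ (Px₂ , _)  = ≡true⇒≢false x₁x₂ (nonadjacent Px₁ Px₂)

  independent-nonadjacent : ∀ {I v w} → Independent G I → v ∈ I → w ∈ I → adj G v w ≡ false
  independent-nonadjacent (_   ∷ _)    (here refl)  (here refl)  = irrefl G _
  independent-nonadjacent (p#I ∷ _)    (here refl)  (there w∈I) = proj₂ (All.lookup p#I w∈I)
  independent-nonadjacent (p#I ∷ _)    (there v∈I) (here refl)  = trans (sym G _ _) (proj₂ (All.lookup p#I v∈I))
  independent-nonadjacent (_   ∷ indI) (there v∈I) (there w∈I) = independent-nonadjacent indI v∈I w∈I

independent⇒starColorable : ∀ {s K} (G : Graph (s + K)) {I} → Independent G I → length I ≡ suc s → StarColorable G K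
independent⇒starColorable {s} {K} G {p ∷ qs} (p#qs ∷ indQs) |I|≡1+s =
  let col , inj = identifyAll qs injectiveColoring (λ v w v≡w → inj₁ (subst-injective (≡-sym |qs|≡s) v≡w)) refl
                    (AllPairs.map proj₁ indQs) (All.map (λ (p≢q , _) q≡p → p≢q (≡-sym q≡p)) p#qs)
  in col , injectiveOutsideIndependent⇒starColoring G col inj λ v∈I w∈I →
       independent-nonadjacent G (p#qs ∷ indQs) (toMember v∈I) (toMember w∈I)
  where
  |qs|≡s : length qs ≡ s
  |qs|≡s = suc-injective |I|≡1+s
  injectiveColoring : Fin (s + K) → Fin (length qs + K)
  injectiveColoring = subst (λ m → Fin (m + K)) (≡-sym |qs|≡s)
  toMember : ∀ {v} → v ∈ qs ⊎ v ≡ p → v ∈ p ∷ qs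
  toMember (inj₁ v∈qs) = there v∈qs
  toMember (inj₂ v≡p)  = here v≡p

mainTheorem17 : (n : ℕ) (G : Graph n) → Connected G → 5 ≤ n →
    StarChromaticNumber G (n ∸ 2) →
    n * (n ∸ 3) ≤ 6 * edgeCount G
mainTheorem17 (suc (suc (suc K))) G _ (s≤s (s≤s (s≤s _))) (_ , noFewerColors) = begin
  n * (n ∸ 3)                ≡⟨ cong (λ m → m * (m ∸ 3)) (∑-one n) ⟨
  size V * (size V ∸ 3)      ≤⟨ turánBound G noIndependent4 V ⟩
  3 * edgesBetween G V V     ≡⟨ cong (3 *_) (handshake G) ⟨
  3 * (2 * edgeCount G)      ≡⟨ *-assoc 3 2 (edgeCount G) ⟨
  6 * edgeCount G            ∎
  where
  open ≤-Reasoning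
  n = suc (suc (suc K))
  V : Fin n → Bool
  V _ = true
  noIndependent4 : NoIndependentSetOfSize G 4
  noIndependent4 I indI |I|≡4 = noFewerColors K (n<1+n K) (independent⇒starColorable G indI |I|≡4)
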